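{- (i) If excluded middle holds, then the intrinsic apartness on any dcpo is tight. Conversely, if $D$ is a continuous dcpo having elements $x\sqsubseteq y$ with $x\# y$ (intrinsic apartness), then tightness of the intrinsic apartness on $D$ implies excluded middle. (ii) If excluded middle holds, then the intrinsic apartness on any dcpo is cotransitive. Conversely, if $D$ is a continuous dcpo having elements $x\sqsubseteq y$ with $x\# y$, then cotransitivity of the intrinsic apartness on $D$ implies excluded middle. (iii) In particular, if the intrinsic apartness on the Sierpiński domain $\mathbb S$ is tight or cotransitive, then excluded middle follows.
   Context: We work constructively: informal set theory without excluded middle or choice. A dcpo is a poset in which every directed subset (inhabited, any two elements have an upper bound in it) has a supremum. In a dcpo, $x\ll y$ if for every directed $S$ with $y\sqsubseteq\bigsqcup S$ some $s\in S$ satisfies $x\sqsubseteq s$; $D$ is continuous if for every $x$ the set $\{y\mid y\ll x\}$ is directed with supremum $x$. A subset $U$ is Scott open if it is an upper set and $\bigsqcup S\in U$ for directed $S$ implies some $s\in S$ is in $U$. Write $x\not\leq_{\mathrm S}y$ if some Scott open contains $x$ but not $y$; the intrinsic apartness is $x\# y$ iff ($x\not\leq_{\mathrm S}y$ or $y\not\leq_{\mathrm S}x$). A relation $\#$ is tight if $\neg(x\# y)$ implies $x=y$, and cotransitive if $x\# y$ implies ($x\# z$ or $y\# z$) for all $x,y,z$. The Sierpiński domain $\mathbb S$ is the powerset of a singleton $\{*\}$ ordered by inclusion (suprema are unions). Excluded middle: $P\vee\neg P$ for every proposition $P$. -}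

module Defs where

open import Level using (Level; _⊔_; suc)
open import Data.Product using (Σ; _×_; _,_; proj₁; proj₂)
open import Data.Sum using (_⊎_; inj₁; inj₂)
open import Data.Unit.Polymorphic using (⊤)
open import Relation.Nullary using (¬_)
open import Relation.Binary using (Rel; IsPartialOrder)
open import Function using (_↔_)

IsDirected : ∀ {c 𝓥} {C : Set c} (_⊑_ : Rel C 𝓥) {I : Set 𝓥} → (I → C) → Set 𝓥
IsDirected _⊑_ {I} α = I × (∀ i j → Σ I λ k → (α i ⊑ α k) × (α j ⊑ α k))

record Dcpo (c 𝓥 : Level) : Set (suc (c ⊔ 𝓥)) where
  field
    Carrier        : Set c
    _≈_            : Rel Carrier 𝓥
    _⊑_            : Rel Carrier 𝓥
    isPartialOrder : IsPartialOrder _≈_ _⊑_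
    sup            : {I : Set 𝓥} (α : I → Carrier) → IsDirected _⊑_ α → Carrier
    sup-upper        : {I : Set 𝓥} (α : I → Carrier) (δ : IsDirected _⊑_ α) →
                     ∀ i → α i ⊑ sup α δ
    sup-least        : {I : Set 𝓥} (α : I → Carrier) (δ : IsDirected _⊑_ α) →
                     ∀ u → (∀ i → α i ⊑ u) → sup α δ ⊑ u

module _ {c 𝓥 : Level} (D : Dcpo c 𝓥) where
  open Dcpo D

  IsUpper : (Carrier → Set 𝓥) → Set (c ⊔ 𝓥)
  IsUpper U = ∀ x y → x ⊑ y → U x → U y

  IsScottOpen : (Carrier → Set 𝓥) → Set (c ⊔ suc 𝓥)
  IsScottOpen U = IsUpper U ×
    (∀ {I : Set 𝓥} (α : I → Carrier) (δ : IsDirected _⊑_ α) →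
       U (sup α δ) → Σ I λ i → U (α i))

  _≰S_ : Carrier → Carrier → Set (c ⊔ suc 𝓥)
  x ≰S y = Σ (Carrier → Set 𝓥) λ U → IsScottOpen U × U x × ¬ U y

  _#_ : Carrier → Carrier → Set (c ⊔ suc 𝓥)
  x # y = (x ≰S y) ⊎ (y ≰S x)

  Tight : Set (c ⊔ suc 𝓥)
  Tight = ∀ x y → ¬ (x # y) → x ≈ y

  Cotransitive : Set (c ⊔ suc 𝓥)
  Cotransitive = ∀ x y z → x # y → (x # z) ⊎ (y # z)

  _≪_ : Carrier → Carrier → Set (c ⊔ suc 𝓥)
  x ≪ y = ∀ {I : Set 𝓥} (α : I → Carrier) (δ : IsDirected _⊑_ α) →
            y ⊑ sup α δ → Σ I λ i → x ⊑ α i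

  IsContinuous : Set (c ⊔ suc 𝓥)
  IsContinuous = ∀ x →
      (Σ Carrier λ y → y ≪ x)
    × (∀ y₁ y₂ → y₁ ≪ x → y₂ ≪ x →
         Σ Carrier λ y → (y ≪ x) × (y₁ ⊑ y) × (y₂ ⊑ y))
    × (∀ y → y ≪ x → y ⊑ x)
    × (∀ u → (∀ y → y ≪ x → y ⊑ u) → x ⊑ u)

  HasApartComparable : Set (c ⊔ suc 𝓥)
  HasApartComparable = Σ Carrier λ x → Σ Carrier λ y → (x ⊑ y) × (x # y)

EM : (𝓥 : Level) → Set (suc 𝓥)
EM 𝓥 = (P : Set 𝓥) → P ⊎ ¬ P

-- The Sierpiński domain: subsets of the singleton {*} (as 𝓥-valued predicates
-- on ⊤), ordered by inclusion, with equality mutual inclusion; sups are unions.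
_⊆_ : ∀ {𝓥} → Rel (⊤ {𝓥} → Set 𝓥) 𝓥
A ⊆ B = ∀ t → A t → B t

_≐_ : ∀ {𝓥} → Rel (⊤ {𝓥} → Set 𝓥) 𝓥
A ≐ B = (A ⊆ B) × (B ⊆ A)

⊆-po : ∀ {𝓥} → IsPartialOrder (_≐_ {𝓥}) _⊆_
⊆-po = record
  { isPreorder = record
    { isEquivalence = record
      { refl = (λ t a → a) , (λ t a → a)
      ; sym = λ e → proj₂ e , proj₁ e
      ; trans = λ e f → (λ t a → proj₁ f t (proj₁ e t a)) , (λ t a → proj₂ e t (proj₂ f t a)) }
    ; reflexive = proj₁
    ; trans = λ f g t a → g t (f t a) }
  ; antisym = _,_ }

𝕊 : (𝓥 : Level) → Dcpo (suc 𝓥) 𝓥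
𝕊 𝓥 = record
  { Carrier = ⊤ {𝓥} → Set 𝓥
  ; _≈_ = _≐_
  ; _⊑_ = _⊆_
  ; isPartialOrder = ⊆-po
  ; sup = λ {I} α δ t → Σ I λ i → α i t
  ; sup-upper = λ α δ i t a → i , a
  ; sup-least = λ α δ u h t p → h (proj₁ p) t (proj₂ p) }

-- Under excluded middle, x ≰S y is equivalent to x ⋢ y, because the complement of the
-- principal down-set ↓y is then Scott open; tightness and cotransitivity follow from
-- antisymmetry and transitivity of ⊑.  Conversely, if x ⊑ y and y ≰S x, then for any
-- proposition P the supremum s of {x} ∪ {y | P} lies between x and y, and a Scott open
-- set separating s from x can only contain s because of P.  Tightness applied to y and s
-- makes P ¬¬-stable, cotransitivity applied to y # x and s decides P.
module Submission where

open import Defs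
open import Level using (Level)
open import Data.Product using (_×_; Σ; _,_)
open import Data.Sum using (_⊎_; inj₁; inj₂)
open import Data.Empty using (⊥-elim)
open import Data.Empty.Polymorphic using (⊥)
open import Data.Unit.Polymorphic using (⊤; tt)
open import Function using (_∘_)
open import Relation.Nullary using (¬_)
open import Relation.Binary using (IsPartialOrder)

EM⇒¬¬-stable : ∀ {𝓥} → EM 𝓥 → {P : Set 𝓥} → ¬ ¬ P → P
EM⇒¬¬-stable em {P} ¬¬p with em P
... | inj₁ p  = p
... | inj₂ ¬p = ⊥-elim (¬¬p ¬p)

¬¬-stable⇒EM : ∀ {𝓥} → ({P : Set 𝓥} → ¬ ¬ P → P) → EM 𝓥
¬¬-stable⇒EM stable P = stable λ ¬em → ¬em (inj₂ (¬em ∘ inj₁))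

module _ {c 𝓥 : Level} (D : Dcpo c 𝓥) where
  open Dcpo D
  open IsPartialOrder isPartialOrder using (antisym; reflexive)
    renaming (refl to ⊑-refl; trans to ⊑-trans)

  ≰S⇒⋢ : ∀ {x y} → _≰S_ D x y → ¬ (x ⊑ y)
  ≰S⇒⋢ (U , (upper , _) , Ux , ¬Uy) x⊑y = ¬Uy (upper _ _ x⊑y Ux)

  module _ (em : EM 𝓥) where

    ⋢-isScottOpen : ∀ y → IsScottOpen D (λ z → ¬ (z ⊑ y))
    ⋢-isScottOpen y = upper , inaccessible
      where
      upper : IsUpper D (λ z → ¬ (z ⊑ y))
      upper a b a⊑b b⋢y b⊑y = b⋢y (⊑-trans a⊑b b⊑y)

      inaccessible : ∀ {I : Set 𝓥} (α : I → Carrier) (δ : IsDirected _⊑_ α) →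
                     ¬ (sup α δ ⊑ y) → Σ I λ i → ¬ (α i ⊑ y)
      inaccessible α δ sup⋢y = EM⇒¬¬-stable em λ none →
        sup⋢y (sup-least α δ y λ i → EM⇒¬¬-stable em λ αi⋢y → none (i , αi⋢y))

    ⋢⇒≰S : ∀ {x y} → ¬ (x ⊑ y) → _≰S_ D x y
    ⋢⇒≰S {y = y} x⋢y = (λ z → ¬ (z ⊑ y)) , ⋢-isScottOpen y , x⋢y , λ ¬y⊑y → ¬y⊑y ⊑-refl

    EM⇒tight : Tight D
    EM⇒tight x y ¬x#y = antisym (⊑-of inj₁) (⊑-of inj₂)
      where
      ⊑-of : ∀ {a b} → (_≰S_ D a b → _#_ D x y) → a ⊑ b
      ⊑-of into# = EM⇒¬¬-stable em (¬x#y ∘ into# ∘ ⋢⇒≰S)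

    EM⇒cotransitive : Cotransitive D
    EM⇒cotransitive x y z (inj₁ x≰y) with em (x ⊑ z)
    ... | inj₁ x⊑z = inj₂ (inj₂ (⋢⇒≰S λ z⊑y → ≰S⇒⋢ x≰y (⊑-trans x⊑z z⊑y)))
    ... | inj₂ x⋢z = inj₁ (inj₁ (⋢⇒≰S x⋢z))
    EM⇒cotransitive x y z (inj₂ y≰x) with em (y ⊑ z)
    ... | inj₁ y⊑z = inj₁ (inj₂ (⋢⇒≰S λ z⊑x → ≰S⇒⋢ y≰x (⊑-trans y⊑z z⊑x)))
    ... | inj₂ y⋢z = inj₂ (inj₁ (⋢⇒≰S y⋢z))

  module JoinIf {x y : Carrier} (x⊑y : x ⊑ y) (P : Set 𝓥) where
    α : ⊤ {𝓥} ⊎ P → Carrier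
    α (inj₁ _) = x
    α (inj₂ _) = y

    α⊑y : ∀ i → α i ⊑ y
    α⊑y (inj₁ _) = x⊑y
    α⊑y (inj₂ _) = ⊑-refl

    α-isDirected : IsDirected _⊑_ α
    α-isDirected = inj₁ tt , bound
      where
      bound : ∀ i j → Σ (⊤ ⊎ P) λ k → (α i ⊑ α k) × (α j ⊑ α k)
      bound (inj₁ _) (inj₁ _) = inj₁ tt , ⊑-refl , ⊑-refl
      bound i        (inj₂ p) = inj₂ p , α⊑y i , ⊑-refl
      bound (inj₂ p) j        = inj₂ p , ⊑-refl , α⊑y j

    s : Carrier
    s = sup α α-isDirected

    x⊑s : x ⊑ s
    x⊑s = sup-upper α α-isDirected (inj₁ tt)

    s⊑y : s ⊑ y
    s⊑y = sup-least α α-isDirected y α⊑y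

    P⇒y⊑s : P → y ⊑ s
    P⇒y⊑s p = sup-upper α α-isDirected (inj₂ p)

    s≰x⇒P : _≰S_ D s x → P
    s≰x⇒P (V , (_ , inaccessible) , Vs , ¬Vx) with inaccessible α α-isDirected Vs
    ... | inj₁ _ , Vx = ⊥-elim (¬Vx Vx)
    ... | inj₂ p , _  = p

    y≰s⇒¬P : _≰S_ D y s → ¬ P
    y≰s⇒¬P y≰s = ≰S⇒⋢ y≰s ∘ P⇒y⊑s

    tight⇒¬¬-stable : _≰S_ D y x → Tight D → ¬ ¬ P → P
    tight⇒¬¬-stable (U , U-open@(upper , _) , Uy , ¬Ux) tight ¬¬p =
      s≰x⇒P (U , U-open , upper _ _ (reflexive y≈s) Uy , ¬Ux)
      where
      y≈s : y ≈ s
      y≈s = tight y s λ { (inj₁ y≰s) → ¬¬p (y≰s⇒¬P y≰s)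
                        ; (inj₂ s≰y) → ≰S⇒⋢ s≰y s⊑y }

    cotransitive⇒decidable : _≰S_ D y x → Cotransitive D → P ⊎ ¬ P
    cotransitive⇒decidable y≰x cotransitive with cotransitive y x s (inj₁ y≰x)
    ... | inj₁ (inj₁ y≰s) = inj₂ (y≰s⇒¬P y≰s)
    ... | inj₁ (inj₂ s≰y) = ⊥-elim (≰S⇒⋢ s≰y s⊑y)
    ... | inj₂ (inj₁ x≰s) = ⊥-elim (≰S⇒⋢ x≰s x⊑s)
    ... | inj₂ (inj₂ s≰x) = inj₁ (s≰x⇒P s≰x)

  apartComparable⇒≰S : HasApartComparable D →
                       Σ Carrier λ x → Σ Carrier λ y → (x ⊑ y) × _≰S_ D y x
  apartComparable⇒≰S (x , y , x⊑y , inj₁ x≰y) = ⊥-elim (≰S⇒⋢ x≰y x⊑y)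
  apartComparable⇒≰S (x , y , x⊑y , inj₂ y≰x) = x , y , x⊑y , y≰x

  tight⇒EM : HasApartComparable D → Tight D → EM 𝓥
  tight⇒EM apart tight with apartComparable⇒≰S apart
  ... | _ , _ , x⊑y , y≰x = ¬¬-stable⇒EM λ {P} → JoinIf.tight⇒¬¬-stable x⊑y P y≰x tight

  cotransitive⇒EM : HasApartComparable D → Cotransitive D → EM 𝓥
  cotransitive⇒EM apart cotransitive P with apartComparable⇒≰S apart
  ... | _ , _ , x⊑y , y≰x = JoinIf.cotransitive⇒decidable x⊑y P y≰x cotransitive

𝕊-hasApartComparable : ∀ {𝓥} → HasApartComparable (𝕊 𝓥)
𝕊-hasApartComparable {𝓥} = (λ _ → ⊥) , (λ _ → ⊤) , (λ _ ()) , inj₂ (∋tt , ∋tt-open , tt , λ ())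
  where
  ∋tt : (⊤ {𝓥} → Set 𝓥) → Set 𝓥
  ∋tt A = A tt

  ∋tt-open : IsScottOpen (𝕊 𝓥) ∋tt
  ∋tt-open = (λ A B A⊆B → A⊆B tt) , λ α δ sup∋tt → sup∋tt

theorem5p7 : ∀ {c 𝓥 : Level}
    → ((EM 𝓥 → (D : Dcpo c 𝓥) → Tight D)
       × ((D : Dcpo c 𝓥) → IsContinuous D → HasApartComparable D → Tight D → EM 𝓥))
    × ((EM 𝓥 → (D : Dcpo c 𝓥) → Cotransitive D)
       × ((D : Dcpo c 𝓥) → IsContinuous D → HasApartComparable D → Cotransitive D → EM 𝓥))
    × ((Tight (𝕊 𝓥) ⊎ Cotransitive (𝕊 𝓥)) → EM 𝓥)
theorem5p7 {𝓥 = 𝓥} =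
  ((λ em D → EM⇒tight D em) , (λ D _ → tight⇒EM D)) ,
  ((λ em D → EM⇒cotransitive D em) , (λ D _ → cotransitive⇒EM D)) ,
  λ { (inj₁ tight)        → tight⇒EM (𝕊 𝓥) 𝕊-hasApartComparable tight
    ; (inj₂ cotransitive) → cotransitive⇒EM (𝕊 𝓥) 𝕊-hasApartComparable cotransitive }
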